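{- Let $\ell\ge1$ and $d\ge4$ be integers, let $C$ be the reflexive cycle of length $d$, and let $i\in\{0,1,\dots,\ell-1\}$. Then $H_1$ of the clique complex of $P_\ell\times C$ is infinite cyclic, generated by the class of the slice $i\times C$: $H_1=\langle [i\times C]\rangle\cong\mathbb{Z}$.
   Context: $P_\ell$ is the reflexive path on vertices $0,\dots,\ell$; $P_\ell\times C$ is the categorical product (vertex set $V(P_\ell)\times V(C)$, $(a,b)\sim(a',b')$ iff $a\sim a'$ and $b\sim b'$); $i\times C$ is the copy $\{(i,c)\}$ of $C$ viewed as a cycle. Clique complex of a reflexive graph: $n$-simplices are ordered tuples of vertices pairwise equal or adjacent, integer chain groups, boundary $\delta_n([v_0,\dots,v_n])=\sum_{i=0}^n(-1)^i[\dots,\widehat{v_i},\dots]$; $H_1=\ker\delta_1/\operatorname{im}\delta_2$; cycles identified with the 1-chain of their consecutive edges. -}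

module Defs where

open import Data.Nat using (ℕ; zero; suc)
import Data.Nat as ℕ
open import Data.Fin using (Fin; toℕ)
import Data.Fin as Fin
open import Data.Integer using (ℤ; _+_; _-_; _*_; 0ℤ; 1ℤ)
open import Data.Product using (Σ; _×_; _,_; proj₁; proj₂; ∃)
open import Data.Sum using (_⊎_)
open import Data.Bool using (Bool; if_then_else_; _∧_)
open import Data.List using (List; foldr; map; allFin; cartesianProduct)
open import Relation.Nullary using (¬_; Dec)
open import Relation.Nullary.Decidable using (⌊_⌋; _×-dec_; _⊎-dec_)
open import Relation.Binary.PropositionalEquality using (_≡_)

PathAdj : {ℓ : ℕ} → Fin (suc ℓ) → Fin (suc ℓ) → Set
PathAdj a a' = (toℕ a ≡ toℕ a') ⊎ (suc (toℕ a) ≡ toℕ a') ⊎ (suc (toℕ a') ≡ toℕ a)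

CycSucc : (d : ℕ) → Fin d → Fin d → Set
CycSucc d b b' = (toℕ b' ≡ suc (toℕ b)) ⊎ ((suc (toℕ b) ≡ d) × (toℕ b' ≡ 0))

cycSucc? : (d : ℕ) → (b b' : Fin d) → Dec (CycSucc d b b')
cycSucc? d b b' = (toℕ b' ℕ.≟ suc (toℕ b)) ⊎-dec ((suc (toℕ b) ℕ.≟ d) ×-dec (toℕ b' ℕ.≟ 0))

CycAdj : (d : ℕ) → Fin d → Fin d → Set
CycAdj d b b' = (b ≡ b') ⊎ CycSucc d b b' ⊎ CycSucc d b' b

-- The clique complex of the categorical product P_ℓ × C, with integer chains.
module Complex (ℓ d : ℕ) where

  Vertex : Set
  Vertex = Fin (suc ℓ) × Fin d

  Adj : Vertex → Vertex → Set
  Adj (a , b) (a' , b') = PathAdj a a' × CycAdj d b b'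

  EqOrAdj : Vertex → Vertex → Set
  EqOrAdj u v = (u ≡ v) ⊎ Adj u v

  Simplex₁ : Vertex → Vertex → Set
  Simplex₁ u v = EqOrAdj u v

  Simplex₂ : Vertex → Vertex → Vertex → Set
  Simplex₂ u v w = EqOrAdj u v × EqOrAdj u w × EqOrAdj v w

  -- Since the vertex set is finite, the free abelian group on the
  -- n-simplices is the group of ℤ-valued functions on n-tuples of vertices
  -- vanishing off the n-simplices.
  Fun₀ Fun₁ Fun₂ : Set
  Fun₀ = Vertex → ℤ
  Fun₁ = Vertex → Vertex → ℤ
  Fun₂ = Vertex → Vertex → Vertex → ℤ

  IsChain₁ : Fun₁ → Set
  IsChain₁ c = ∀ u v → ¬ Simplex₁ u v → c u v ≡ 0ℤ

  IsChain₂ : Fun₂ → Set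
  IsChain₂ c = ∀ u v w → ¬ Simplex₂ u v w → c u v w ≡ 0ℤ

  vertices : List Vertex
  vertices = cartesianProduct (allFin (suc ℓ)) (allFin d)

  ∑ : (Vertex → ℤ) → ℤ
  ∑ f = foldr _+_ 0ℤ (map f vertices)

  -- δ₁ [v₀,v₁] = [v₁] - [v₀], extended linearly
  δ₁ : Fun₁ → Fun₀
  δ₁ c x = ∑ (λ u → c u x) - ∑ (λ v → c x v)

  -- δ₂ [v₀,v₁,v₂] = [v₁,v₂] - [v₀,v₂] + [v₀,v₁], extended linearly
  δ₂ : Fun₂ → Fun₁
  δ₂ c x y = ∑ (λ w → c w x y - c x w y + c x y w)

  _≈₁_ : Fun₁ → Fun₁ → Set
  c ≈₁ c' = ∀ u v → c u v ≡ c' u v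

  _≈₀_ : Fun₀ → Fun₀ → Set
  c ≈₀ c' = ∀ x → c x ≡ c' x

  zero₀ : Fun₀
  zero₀ _ = 0ℤ

  _·_ : ℤ → Fun₁ → Fun₁
  (k · c) u v = k * c u v

  _−₁_ : Fun₁ → Fun₁ → Fun₁
  (c −₁ c') u v = c u v - c' u v

  IsCycle₁ : Fun₁ → Set
  IsCycle₁ c = IsChain₁ c × (δ₁ c ≈₀ zero₀)

  IsBoundary₁ : Fun₁ → Set
  IsBoundary₁ c = Σ Fun₂ λ b → IsChain₂ b × (c ≈₁ δ₂ b)

  slice : Fin (suc ℓ) → Fun₁
  slice i (a , b) (a' , b') =
    if ⌊ a Fin.≟ i ⌋ ∧ ⌊ a' Fin.≟ i ⌋ ∧ ⌊ cycSucc? d b b' ⌋ then 1ℤ else 0ℤ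

  -- H₁ = Z₁ / B₁ is infinite cyclic generated by the class [z]:
  -- z is a cycle, every cycle is homologous to an integer multiple of z,
  -- and k·z is a boundary only for k = 0 (so k ↦ k[z] is an iso ℤ ≅ H₁).
  H₁InfiniteCyclicGeneratedBy : Fun₁ → Set
  H₁InfiniteCyclicGeneratedBy z =
    IsCycle₁ z
    × (∀ c → IsCycle₁ c → ∃ λ (k : ℤ) → IsBoundary₁ (c −₁ (k · z)))
    × (∀ (k : ℤ) → IsBoundary₁ (k · z) → k ≡ 0ℤ)

-- The winding number of an edge around the cycle coordinate (+1 on the edge from d − 1 to 0,
-- −1 on its reverse, 0 otherwise) is a 1-cocycle of the clique complex, because for d ≥ 4 no
-- triangle winds around C; it takes the value 1 on every slice i × C, so no nonzero multiple
-- of a slice bounds. Conversely, take the spanning tree that runs around the rim at level 0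
-- and then up the columns. For every edge u v, the closed walk root → u → v → root minus its
-- winding number times the rim bounds: it vanishes for rim edges and column edges, and it
-- propagates from one level to the next through the two triangles filling each square.
-- Summing over a cycle c, the tree paths cancel, so c is homologous to ⟨c, winding⟩ times the
-- rim, and so to that multiple of any slice.

module Submission where

open import Defs
open import Data.Nat as ℕ using (ℕ; zero; suc; _≤_; z≤n; s≤s)
import Data.Nat.Properties as ℕP
open import Data.Nat.DivMod using (_mod_; m<n⇒m%n≡m; n%n≡0)
open import Data.Fin as Fin using (Fin; toℕ; inject₁; fromℕ)
import Data.Fin.Properties as FinP
open import Data.Fin.Induction using (<-weakInduction)
open import Data.Integer as ℤ using (ℤ; _+_; _-_; _*_; -_; 0ℤ; 1ℤ)
import Data.Integer.Properties as ℤP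
open import Data.Integer.Tactic.RingSolver using (solve-∀)
open import Algebra.Properties.CommutativeSemigroup ℤP.+-commutativeSemigroup using (interchange)
open import Data.List using (List; []; _∷_; foldr; map; _++_; allFin; cartesianProduct)
import Data.List.Properties as ListP
open import Data.Product using (_×_; _,_; proj₁; proj₂; ∃)
open import Data.Sum using (_⊎_; inj₁; inj₂)
open import Data.Empty using (⊥-elim)
open import Relation.Nullary using (¬_; Dec; yes; no; does)
open import Data.Bool using (if_then_else_; _∧_)
open import Relation.Nullary.Decidable using (_×-dec_; _⊎-dec_; ⌊_⌋)
import Data.Product.Properties as ProductP
open import Relation.Binary.PropositionalEquality
open import Function using (_∘_; id)

sumOver : {A : Set} → List A → (A → ℤ) → ℤ
sumOver xs f = foldr _+_ 0ℤ (map f xs)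

module _ {A : Set} where

  sumOver-cong : (xs : List A) {f g : A → ℤ} → (∀ x → f x ≡ g x) → sumOver xs f ≡ sumOver xs g
  sumOver-cong []       f≗g = refl
  sumOver-cong (x ∷ xs) f≗g = cong₂ _+_ (f≗g x) (sumOver-cong xs f≗g)

  sumOver-zero : (xs : List A) {f : A → ℤ} → (∀ x → f x ≡ 0ℤ) → sumOver xs f ≡ 0ℤ
  sumOver-zero []       f≗0 = refl
  sumOver-zero (x ∷ xs) f≗0 = cong₂ _+_ (f≗0 x) (sumOver-zero xs f≗0)

  sumOver-+ : (xs : List A) (f g : A → ℤ) → sumOver xs (λ x → f x + g x) ≡ sumOver xs f + sumOver xs g
  sumOver-+ []       f g = refl
  sumOver-+ (x ∷ xs) f g =
    trans (cong ((f x + g x) +_) (sumOver-+ xs f g)) (interchange (f x) (g x) _ _)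

  sumOver-neg : (xs : List A) (f : A → ℤ) → sumOver xs (λ x → - f x) ≡ - sumOver xs f
  sumOver-neg []       f = refl
  sumOver-neg (x ∷ xs) f =
    trans (cong (- f x +_) (sumOver-neg xs f)) (sym (ℤP.neg-distrib-+ (f x) _))

  sumOver-- : (xs : List A) (f g : A → ℤ) → sumOver xs (λ x → f x - g x) ≡ sumOver xs f - sumOver xs g
  sumOver-- xs f g = trans (sumOver-+ xs f (λ x → - g x)) (cong (sumOver xs f +_) (sumOver-neg xs g))

  sumOver-*ˡ : (xs : List A) (k : ℤ) (f : A → ℤ) → sumOver xs (λ x → k * f x) ≡ k * sumOver xs f
  sumOver-*ˡ []       k f = sym (ℤP.*-zeroʳ k)
  sumOver-*ˡ (x ∷ xs) k f =
    trans (cong (k * f x +_) (sumOver-*ˡ xs k f)) (sym (ℤP.*-distribˡ-+ k (f x) _))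

  sumOver-*ʳ : (xs : List A) (k : ℤ) (f : A → ℤ) → sumOver xs (λ x → f x * k) ≡ sumOver xs f * k
  sumOver-*ʳ xs k f = begin
    sumOver xs (λ x → f x * k) ≡⟨ sumOver-cong xs (λ x → ℤP.*-comm (f x) k) ⟩
    sumOver xs (λ x → k * f x) ≡⟨ sumOver-*ˡ xs k f ⟩
    k * sumOver xs f           ≡⟨ ℤP.*-comm k _ ⟩
    sumOver xs f * k           ∎
    where open ≡-Reasoning

  sumOver-++ : (xs ys : List A) (f : A → ℤ) → sumOver (xs ++ ys) f ≡ sumOver xs f + sumOver ys f
  sumOver-++ []       ys f = sym (ℤP.+-identityˡ _)
  sumOver-++ (x ∷ xs) ys f = trans (cong (f x +_) (sumOver-++ xs ys f)) (sym (ℤP.+-assoc (f x) _ _))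

sumOver-map : {A B : Set} (xs : List A) (h : A → B) (f : B → ℤ) → sumOver (map h xs) f ≡ sumOver xs (f ∘ h)
sumOver-map []       h f = refl
sumOver-map (x ∷ xs) h f = cong (f (h x) +_) (sumOver-map xs h f)

sumOver-comm : {A B : Set} (xs : List A) (ys : List B) (g : A → B → ℤ) →
  sumOver xs (λ x → sumOver ys (g x)) ≡ sumOver ys (λ y → sumOver xs (λ x → g x y))
sumOver-comm []       ys g = sym (sumOver-zero ys (λ _ → refl))
sumOver-comm (x ∷ xs) ys g =
  trans (cong (sumOver ys (g x) +_) (sumOver-comm xs ys g))
        (sym (sumOver-+ ys (g x) (λ y → sumOver xs (λ x′ → g x′ y))))

sumOver-cartesianProduct : {A B : Set} (xs : List A) (ys : List B) (f : A × B → ℤ) →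
  sumOver (cartesianProduct xs ys) f ≡ sumOver xs (λ a → sumOver ys (λ b → f (a , b)))
sumOver-cartesianProduct []       ys f = refl
sumOver-cartesianProduct (x ∷ xs) ys f =
  trans (sumOver-++ (map (x ,_) ys) _ f)
        (cong₂ _+_ (sumOver-map ys (x ,_) f) (sumOver-cartesianProduct xs ys f))

sumOver-allFin-suc : (n : ℕ) (f : Fin (suc n) → ℤ) →
  sumOver (allFin (suc n)) f ≡ f Fin.zero + sumOver (allFin n) (f ∘ Fin.suc)
sumOver-allFin-suc n f = cong (f Fin.zero +_)
  (trans (cong (λ xs → sumOver xs f) (sym (ListP.map-tabulate id Fin.suc)))
         (sumOver-map (allFin n) Fin.suc f))

𝟙 : {P : Set} → Dec P → ℤ
𝟙 p = if does p then 1ℤ else 0ℤ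

𝟙-yes : {P : Set} (p : Dec P) → P → 𝟙 p ≡ 1ℤ
𝟙-yes (yes _) _ = refl
𝟙-yes (no ¬p) p = ⊥-elim (¬p p)

𝟙-no : {P : Set} (p : Dec P) → ¬ P → 𝟙 p ≡ 0ℤ
𝟙-no (yes p) ¬p = ⊥-elim (¬p p)
𝟙-no (no _)  _  = refl

𝟙-× : {P Q : Set} (p : Dec P) (q : Dec Q) → 𝟙 p * 𝟙 q ≡ 𝟙 (p ×-dec q)
𝟙-× (yes _) (yes _) = refl
𝟙-× (yes _) (no _)  = refl
𝟙-× (no _)  (yes _) = refl
𝟙-× (no _)  (no _)  = refl

if-∧≡𝟙 : {P Q R : Set} (p : Dec P) (q : Dec Q) (r : Dec R) →
  (if ⌊ p ⌋ ∧ ⌊ q ⌋ ∧ ⌊ r ⌋ then 1ℤ else 0ℤ) ≡ 𝟙 (p ×-dec q ×-dec r)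
if-∧≡𝟙 (no _)  _       _       = refl
if-∧≡𝟙 (yes _) (no _)  _       = refl
if-∧≡𝟙 (yes _) (yes _) (no _)  = refl
if-∧≡𝟙 (yes _) (yes _) (yes _) = refl

δ : {n : ℕ} → Fin n → Fin n → ℤ
δ i j = 𝟙 (i Fin.≟ j)

δ-≡ : {n : ℕ} {i j : Fin n} → i ≡ j → δ i j ≡ 1ℤ
δ-≡ {i = i} {j} = 𝟙-yes (i Fin.≟ j)

δ-≢ : {n : ℕ} {i j : Fin n} → i ≢ j → δ i j ≡ 0ℤ
δ-≢ {i = i} {j} = 𝟙-no (i Fin.≟ j)

𝟙≡δ : {P : Set} (p : Dec P) {n : ℕ} {i j : Fin n} → (P → i ≡ j) → (i ≡ j → P) → 𝟙 p ≡ δ i j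
𝟙≡δ (yes x) P⇒i≡j _     = sym (δ-≡ (P⇒i≡j x))
𝟙≡δ (no ¬x) _     i≡j⇒P = sym (δ-≢ (¬x ∘ i≡j⇒P))

δ-sym : {n : ℕ} (i j : Fin n) → δ i j ≡ δ j i
δ-sym i j = 𝟙≡δ (i Fin.≟ j) sym sym

δ-suc : {n : ℕ} (i j : Fin n) → δ (Fin.suc i) (Fin.suc j) ≡ δ i j
δ-suc i j = 𝟙≡δ (Fin.suc i Fin.≟ Fin.suc j) FinP.suc-injective (cong Fin.suc)

δ-cases : {n : ℕ} (i j : Fin n) → δ i j ≡ 0ℤ ⊎ i ≡ j
δ-cases i j with i Fin.≟ j
... | yes i≡j = inj₂ i≡j
... | no _    = inj₁ refl

sumOver-allFin-δ : (n : ℕ) (j : Fin n) (f : Fin n → ℤ) → sumOver (allFin n) (λ i → δ i j * f i) ≡ f j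
sumOver-allFin-δ (suc n) j f = trans (sumOver-allFin-suc n (λ i → δ i j * f i)) (pick j)
  where
  pick : (j : Fin (suc n)) →
    δ Fin.zero j * f Fin.zero + sumOver (allFin n) (λ i → δ (Fin.suc i) j * f (Fin.suc i)) ≡ f j
  pick Fin.zero = trans
    (cong₂ _+_ (ℤP.*-identityˡ (f Fin.zero)) (sumOver-zero (allFin n) (λ i → ℤP.*-zeroˡ (f (Fin.suc i)))))
    (ℤP.+-identityʳ (f Fin.zero))
  pick (Fin.suc j) = trans (ℤP.+-identityˡ _)
    (trans (sumOver-cong (allFin n) (λ i → cong (_* f (Fin.suc i)) (δ-suc i j)))
           (sumOver-allFin-δ n j (f ∘ Fin.suc)))

toℕ-mod : {n k : ℕ} .{{_ : ℕ.NonZero k}} → n ℕ.< k → toℕ (n mod k) ≡ n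
toℕ-mod n<k = trans (FinP.toℕ-fromℕ< _) (m<n⇒m%n≡m n<k)

mod-toℕ : {k : ℕ} .{{_ : ℕ.NonZero k}} (i : Fin k) → toℕ i mod k ≡ i
mod-toℕ i = FinP.toℕ-injective (toℕ-mod (FinP.toℕ<n i))

module Chains (ℓ d : ℕ) where
  open Complex ℓ d

  ∑-cong : {f g : Vertex → ℤ} → (∀ x → f x ≡ g x) → ∑ f ≡ ∑ g
  ∑-cong = sumOver-cong vertices

  ∑-zero : {f : Vertex → ℤ} → (∀ x → f x ≡ 0ℤ) → ∑ f ≡ 0ℤ
  ∑-zero = sumOver-zero vertices

  ∑-*ʳ : (k : ℤ) (f : Vertex → ℤ) → ∑ (λ x → f x * k) ≡ ∑ f * k
  ∑-*ʳ = sumOver-*ʳ vertices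

  ∑-comm : (g : Vertex → Vertex → ℤ) → ∑ (λ x → ∑ (g x)) ≡ ∑ (λ y → ∑ (λ x → g x y))
  ∑-comm = sumOver-comm vertices vertices

  ∑-−+ : (f g h : Vertex → ℤ) → ∑ (λ x → f x - g x + h x) ≡ ∑ f - ∑ g + ∑ h
  ∑-−+ f g h = trans (sumOver-+ vertices (λ x → f x - g x) h) (cong (_+ ∑ h) (sumOver-- vertices f g))

  δᵥ : Vertex → Vertex → ℤ
  δᵥ (a , b) (a′ , b′) = δ a a′ * δ b b′

  ∑-δᵥ : (u : Vertex) (f : Vertex → ℤ) → ∑ (λ t → δᵥ t u * f t) ≡ f u
  ∑-δᵥ (a₀ , b₀) f = begin
    ∑ (λ t → δᵥ t (a₀ , b₀) * f t)
      ≡⟨ sumOver-cartesianProduct (allFin (suc ℓ)) (allFin d) _ ⟩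
    sumOver (allFin (suc ℓ)) (λ a → sumOver (allFin d) (λ b → δ a a₀ * δ b b₀ * f (a , b)))
      ≡⟨ sumOver-cong (allFin (suc ℓ)) (λ a → column a) ⟩
    sumOver (allFin (suc ℓ)) (λ a → δ a a₀ * f (a , b₀))
      ≡⟨ sumOver-allFin-δ (suc ℓ) a₀ (λ a → f (a , b₀)) ⟩
    f (a₀ , b₀) ∎
    where
    open ≡-Reasoning
    column : ∀ a → sumOver (allFin d) (λ b → δ a a₀ * δ b b₀ * f (a , b)) ≡ δ a a₀ * f (a , b₀)
    column a = begin
      sumOver (allFin d) (λ b → δ a a₀ * δ b b₀ * f (a , b))
        ≡⟨ sumOver-cong (allFin d) (λ b → ℤP.*-assoc (δ a a₀) (δ b b₀) (f (a , b))) ⟩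
      sumOver (allFin d) (λ b → δ a a₀ * (δ b b₀ * f (a , b)))
        ≡⟨ sumOver-*ˡ (allFin d) (δ a a₀) _ ⟩
      δ a a₀ * sumOver (allFin d) (λ b → δ b b₀ * f (a , b))
        ≡⟨ cong (δ a a₀ *_) (sumOver-allFin-δ d b₀ (λ b → f (a , b))) ⟩
      δ a a₀ * f (a , b₀) ∎

  δᵥ-sym : (u v : Vertex) → δᵥ u v ≡ δᵥ v u
  δᵥ-sym (a , b) (a′ , b′) = cong₂ _*_ (δ-sym a a′) (δ-sym b b′)

  δᵥ-cases : (u v : Vertex) → δᵥ u v ≡ 0ℤ ⊎ u ≡ v
  δᵥ-cases (a , b) (a′ , b′) with δ-cases a a′ | δ-cases b b′
  ... | inj₁ δa≡0    | _          = inj₁ (trans (cong (_* δ b b′) δa≡0) (ℤP.*-zeroˡ (δ b b′)))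
  ... | inj₂ _       | inj₁ δb≡0  = inj₁ (trans (cong (δ a a′ *_) δb≡0) (ℤP.*-zeroʳ (δ a a′)))
  ... | inj₂ refl    | inj₂ refl  = inj₂ refl

  0₁ : Fun₁
  0₁ _ _ = 0ℤ

  infixl 21 _+₁_
  _+₁_ : Fun₁ → Fun₁ → Fun₁
  (c +₁ c′) u v = c u v + c′ u v

  edge : Vertex → Vertex → Fun₁
  edge u v x y = δᵥ x u * δᵥ y v

  triangle : Vertex → Vertex → Vertex → Fun₂
  triangle u v w t₁ t₂ t₃ = δᵥ t₁ u * δᵥ t₂ v * δᵥ t₃ w

  ∂triangle : Vertex → Vertex → Vertex → Fun₁
  ∂triangle u v w x y = edge v w x y - edge u w x y + edge u v x y

  δ₂-triangle : (u v w : Vertex) → δ₂ (triangle u v w) ≈₁ ∂triangle u v w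
  δ₂-triangle u v w x y = begin
    ∑ (λ t → δᵥ t u * δᵥ x v * δᵥ y w - δᵥ x u * δᵥ t v * δᵥ y w + δᵥ x u * δᵥ y v * δᵥ t w)
      ≡⟨ ∑-−+ _ _ _ ⟩
    ∑ (λ t → δᵥ t u * δᵥ x v * δᵥ y w) - ∑ (λ t → δᵥ x u * δᵥ t v * δᵥ y w)
      + ∑ (λ t → δᵥ x u * δᵥ y v * δᵥ t w)
      ≡⟨ cong₂ _+_ (cong₂ _-_ (pick u (λ t → ℤP.*-assoc (δᵥ t u) _ _))
                              (pick v (λ t → first↔second (δᵥ x u) (δᵥ t v) _)))
                   (pick w (λ t → ℤP.*-comm (δᵥ x u * δᵥ y v) (δᵥ t w))) ⟩
    edge v w x y - edge u w x y + edge u v x y ∎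
    where
    open ≡-Reasoning
    first↔second : ∀ a b c → a * b * c ≡ b * (a * c)
    first↔second = solve-∀
    pick : (s : Vertex) {f : Vertex → ℤ} {g : ℤ} → (∀ t → f t ≡ δᵥ t s * g) → ∑ f ≡ g
    pick s {g = g} f≗ = trans (∑-cong f≗) (∑-δᵥ s (λ _ → g))

  triangle-isChain : (u v w : Vertex) → Simplex₂ u v w → IsChain₂ (triangle u v w)
  triangle-isChain u v w σ t₁ t₂ t₃ ¬σ with δᵥ-cases t₁ u | δᵥ-cases t₂ v | δᵥ-cases t₃ w
  ... | inj₁ z | _      | _      rewrite z = refl
  ... | inj₂ _ | inj₁ z | _      rewrite z | ℤP.*-zeroʳ (δᵥ t₁ u) = refl
  ... | inj₂ _ | inj₂ _ | inj₁ z rewrite z = ℤP.*-zeroʳ (δᵥ t₁ u * δᵥ t₂ v)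
  ... | inj₂ refl | inj₂ refl | inj₂ refl = ⊥-elim (¬σ σ)

  isBoundary-resp : {c c′ : Fun₁} → c ≈₁ c′ → IsBoundary₁ c → IsBoundary₁ c′
  isBoundary-resp c≈c′ (b , b-chain , c≈δb) = b , b-chain , λ x y → trans (sym (c≈c′ x y)) (c≈δb x y)

  isBoundary-0 : IsBoundary₁ 0₁
  isBoundary-0 = (λ _ _ _ → 0ℤ) , (λ _ _ _ _ → refl) , λ x y → sym (∑-zero (λ _ → refl))

  isBoundary-triangle : (u v w : Vertex) → Simplex₂ u v w → IsBoundary₁ (∂triangle u v w)
  isBoundary-triangle u v w σ = triangle u v w , triangle-isChain u v w σ , λ x y → sym (δ₂-triangle u v w x y)

  isBoundary-+ : {c c′ : Fun₁} → IsBoundary₁ c → IsBoundary₁ c′ → IsBoundary₁ (c +₁ c′)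
  isBoundary-+ {c} {c′} (b , b-chain , c≈δb) (b′ , b′-chain , c′≈δb′) =
    (λ u v w → b u v w + b′ u v w) ,
    (λ u v w ¬σ → cong₂ _+_ (b-chain u v w ¬σ) (b′-chain u v w ¬σ)) ,
    λ x y → begin
      c x y + c′ x y
        ≡⟨ cong₂ _+_ (c≈δb x y) (c′≈δb′ x y) ⟩
      ∑ (λ w → b w x y - b x w y + b x y w) + ∑ (λ w → b′ w x y - b′ x w y + b′ x y w)
        ≡⟨ sym (sumOver-+ vertices _ _) ⟩
      ∑ (λ w → (b w x y - b x w y + b x y w) + (b′ w x y - b′ x w y + b′ x y w))
        ≡⟨ ∑-cong (λ w → regroup (b w x y) (b′ w x y) (b x w y) (b′ x w y) (b x y w) (b′ x y w)) ⟩
      ∑ (λ w → (b w x y + b′ w x y) - (b x w y + b′ x w y) + (b x y w + b′ x y w)) ∎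
    where
    open ≡-Reasoning
    regroup : ∀ p p′ q q′ r r′ → (p - q + r) + (p′ - q′ + r′) ≡ (p + p′) - (q + q′) + (r + r′)
    regroup = solve-∀

  isBoundary-· : (k : ℤ) {c : Fun₁} → IsBoundary₁ c → IsBoundary₁ (k · c)
  isBoundary-· k {c} (b , b-chain , c≈δb) =
    (λ u v w → k * b u v w) ,
    (λ u v w ¬σ → trans (cong (k *_) (b-chain u v w ¬σ)) (ℤP.*-zeroʳ k)) ,
    λ x y → begin
      k * c x y
        ≡⟨ cong (k *_) (c≈δb x y) ⟩
      k * ∑ (λ w → b w x y - b x w y + b x y w)
        ≡⟨ sym (sumOver-*ˡ vertices k _) ⟩
      ∑ (λ w → k * (b w x y - b x w y + b x y w))
        ≡⟨ ∑-cong (λ w → distribute k (b w x y) (b x w y) (b x y w)) ⟩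
      ∑ (λ w → k * b w x y - k * b x w y + k * b x y w) ∎
    where
    open ≡-Reasoning
    distribute : ∀ k p q r → k * (p - q + r) ≡ k * p - k * q + k * r
    distribute = solve-∀

  isBoundary-−₁ : {c c′ : Fun₁} → IsBoundary₁ c → IsBoundary₁ c′ → IsBoundary₁ (c −₁ c′)
  isBoundary-−₁ {c} {c′} ∂c ∂c′ =
    isBoundary-resp (λ x y → cong (c x y +_) (ℤP.-1*i≡-i (c′ x y))) (isBoundary-+ ∂c (isBoundary-· (- 1ℤ) ∂c′))

  isBoundary-∑ : (F : Vertex → Fun₁) → (∀ u → IsBoundary₁ (F u)) → IsBoundary₁ (λ x y → ∑ (λ u → F u x y))
  isBoundary-∑ F ∂F =
    (λ w x y → ∑ (λ u → B u w x y)) ,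
    (λ t₁ t₂ t₃ ¬σ → ∑-zero (λ u → proj₁ (proj₂ (∂F u)) t₁ t₂ t₃ ¬σ)) ,
    λ x y → begin
      ∑ (λ u → F u x y)
        ≡⟨ ∑-cong (λ u → proj₂ (proj₂ (∂F u)) x y) ⟩
      ∑ (λ u → ∑ (λ w → B u w x y - B u x w y + B u x y w))
        ≡⟨ ∑-comm _ ⟩
      ∑ (λ w → ∑ (λ u → B u w x y - B u x w y + B u x y w))
        ≡⟨ ∑-cong (λ w → ∑-−+ _ _ _) ⟩
      ∑ (λ w → ∑ (λ u → B u w x y) - ∑ (λ u → B u x w y) + ∑ (λ u → B u x y w)) ∎
    where
    open ≡-Reasoning
    B : Vertex → Fun₂
    B u = proj₁ (∂F u)

  ∑² : (Vertex → Vertex → ℤ) → ℤ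
  ∑² f = ∑ (λ u → ∑ (f u))

  ∑³ : (Vertex → Vertex → Vertex → ℤ) → ℤ
  ∑³ F = ∑ (λ u → ∑² (F u))

  ∑²-cong : {f g : Vertex → Vertex → ℤ} → (∀ u v → f u v ≡ g u v) → ∑² f ≡ ∑² g
  ∑²-cong f≗g = ∑-cong (λ u → ∑-cong (f≗g u))

  ∑²-+ : (f g : Vertex → Vertex → ℤ) → ∑² (λ u v → f u v + g u v) ≡ ∑² f + ∑² g
  ∑²-+ f g = trans (∑-cong (λ u → sumOver-+ vertices (f u) (g u))) (sumOver-+ vertices _ _)

  ∑²-− : (f g : Vertex → Vertex → ℤ) → ∑² (λ u v → f u v - g u v) ≡ ∑² f - ∑² g
  ∑²-− f g = trans (∑-cong (λ u → sumOver-- vertices (f u) (g u))) (sumOver-- vertices _ _)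

  ∑³-−+ : (F G H : Vertex → Vertex → Vertex → ℤ) →
    ∑³ (λ u v w → F u v w - G u v w + H u v w) ≡ ∑³ F - ∑³ G + ∑³ H
  ∑³-−+ F G H = trans (∑-cong (λ u → trans (∑-cong (λ v → ∑-−+ (F u v) (G u v) (H u v)))
                                           (∑-−+ (λ v → ∑ (F u v)) (λ v → ∑ (G u v)) (λ v → ∑ (H u v)))))
                      (∑-−+ (λ u → ∑² (F u)) (λ u → ∑² (G u)) (λ u → ∑² (H u)))

  ⟨_∣_⟩ : Fun₁ → Fun₁ → ℤ
  ⟨ c ∣ φ ⟩ = ∑² (λ u v → c u v * φ u v)

  ⟨⟩-resp-≈₁ : {c c′ : Fun₁} (φ : Fun₁) → c ≈₁ c′ → ⟨ c ∣ φ ⟩ ≡ ⟨ c′ ∣ φ ⟩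
  ⟨⟩-resp-≈₁ φ c≈c′ = ∑²-cong (λ u v → cong (_* φ u v) (c≈c′ u v))

  ⟨⟩-· : (k : ℤ) (c φ : Fun₁) → ⟨ k · c ∣ φ ⟩ ≡ k * ⟨ c ∣ φ ⟩
  ⟨⟩-· k c φ = trans (∑-cong (λ u → trans (∑-cong (λ v → ℤP.*-assoc k (c u v) (φ u v))) (sumOver-*ˡ vertices k _)))
                     (sumOver-*ˡ vertices k _)

  pathAdj? : (a a′ : Fin (suc ℓ)) → Dec (PathAdj a a′)
  pathAdj? a a′ = (toℕ a ℕ.≟ toℕ a′) ⊎-dec (suc (toℕ a) ℕ.≟ toℕ a′) ⊎-dec (suc (toℕ a′) ℕ.≟ toℕ a)

  cycAdj? : (b b′ : Fin d) → Dec (CycAdj d b b′)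
  cycAdj? b b′ = (b Fin.≟ b′) ⊎-dec cycSucc? d b b′ ⊎-dec cycSucc? d b′ b

  eqOrAdj? : (u v : Vertex) → Dec (EqOrAdj u v)
  eqOrAdj? u@(a , b) v@(a′ , b′) =
    ProductP.≡-dec Fin._≟_ Fin._≟_ u v ⊎-dec (pathAdj? a a′ ×-dec cycAdj? b b′)

  simplex₂? : (u v w : Vertex) → Dec (Simplex₂ u v w)
  simplex₂? u v w = eqOrAdj? u v ×-dec eqOrAdj? u w ×-dec eqOrAdj? v w

  pathAdj-sym : {a a′ : Fin (suc ℓ)} → PathAdj a a′ → PathAdj a′ a
  pathAdj-sym (inj₁ a≡a′)       = inj₁ (sym a≡a′)
  pathAdj-sym (inj₂ (inj₁ up))   = inj₂ (inj₂ up)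
  pathAdj-sym (inj₂ (inj₂ down)) = inj₂ (inj₁ down)

  cycAdj-sym : {b b′ : Fin d} → CycAdj d b b′ → CycAdj d b′ b
  cycAdj-sym (inj₁ b≡b′)          = inj₁ (sym b≡b′)
  cycAdj-sym (inj₂ (inj₁ succ))   = inj₂ (inj₂ succ)
  cycAdj-sym (inj₂ (inj₂ succ))   = inj₂ (inj₁ succ)

  eqOrAdj-sym : (u v : Vertex) → EqOrAdj u v → EqOrAdj v u
  eqOrAdj-sym u .u (inj₁ refl) = inj₁ refl
  eqOrAdj-sym (a , b) (a′ , b′) (inj₂ (a~a′ , b~b′)) = inj₂ (pathAdj-sym a~a′ , cycAdj-sym b~b′)

  eqOrAdj⇒cycAdj : (u v : Vertex) → EqOrAdj u v → CycAdj d (proj₂ u) (proj₂ v)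
  eqOrAdj⇒cycAdj u .u (inj₁ refl)           = inj₁ refl
  eqOrAdj⇒cycAdj (a , b) (a′ , b′) (inj₂ (_ , b~b′)) = b~b′

  IsCocycle₁ : Fun₁ → Set
  IsCocycle₁ φ = ∀ u v w → Simplex₂ u v w → φ v w - φ u w + φ u v ≡ 0ℤ

  ⟨δ₂∣cocycle⟩≡0 : (φ : Fun₁) → IsCocycle₁ φ → (B : Fun₂) → IsChain₂ B → ⟨ δ₂ B ∣ φ ⟩ ≡ 0ℤ
  ⟨δ₂∣cocycle⟩≡0 φ φ-cocycle B B-chain = begin
    ∑² (λ x y → ∑ (λ w → B w x y - B x w y + B x y w) * φ x y)
      ≡⟨ ∑²-cong (λ x y → trans (sym (∑-*ʳ (φ x y) _))
                                (∑-cong (λ w → distribʳ (B w x y) (B x w y) (B x y w) (φ x y)))) ⟩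
    ∑³ (λ x y w → B w x y * φ x y - B x w y * φ x y + B x y w * φ x y)
      ≡⟨ ∑³-−+ _ _ _ ⟩
    ∑³ (λ x y w → B w x y * φ x y) - ∑³ (λ x y w → B x w y * φ x y) + ∑³ (λ x y w → B x y w * φ x y)
      ≡⟨ cong₂ _+_ (cong₂ _-_ (trans (∑-cong (λ x → ∑-comm _)) (∑-comm _)) (∑-cong (λ x → ∑-comm _))) refl ⟩
    ∑³ (λ t₁ t₂ t₃ → B t₁ t₂ t₃ * φ t₂ t₃) - ∑³ (λ t₁ t₂ t₃ → B t₁ t₂ t₃ * φ t₁ t₃)
      + ∑³ (λ t₁ t₂ t₃ → B t₁ t₂ t₃ * φ t₁ t₂)
      ≡⟨ sym (∑³-−+ _ _ _) ⟩
    ∑³ (λ t₁ t₂ t₃ → B t₁ t₂ t₃ * φ t₂ t₃ - B t₁ t₂ t₃ * φ t₁ t₃ + B t₁ t₂ t₃ * φ t₁ t₂)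
      ≡⟨ ∑-zero (λ t₁ → ∑-zero (λ t₂ → ∑-zero (λ t₃ → vanishes t₁ t₂ t₃))) ⟩
    0ℤ ∎
    where
    open ≡-Reasoning
    distribʳ : ∀ p q r k → (p - q + r) * k ≡ p * k - q * k + r * k
    distribʳ = solve-∀
    distribˡ : ∀ k p q r → k * p - k * q + k * r ≡ k * (p - q + r)
    distribˡ = solve-∀
    vanishes : ∀ t₁ t₂ t₃ →
      B t₁ t₂ t₃ * φ t₂ t₃ - B t₁ t₂ t₃ * φ t₁ t₃ + B t₁ t₂ t₃ * φ t₁ t₂ ≡ 0ℤ
    vanishes t₁ t₂ t₃ = trans (distribˡ (B t₁ t₂ t₃) _ _ _) (by-cases (simplex₂? t₁ t₂ t₃))
      where
      by-cases : Dec (Simplex₂ t₁ t₂ t₃) → B t₁ t₂ t₃ * (φ t₂ t₃ - φ t₁ t₃ + φ t₁ t₂) ≡ 0ℤ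
      by-cases (yes σ) rewrite φ-cocycle t₁ t₂ t₃ σ = ℤP.*-zeroʳ (B t₁ t₂ t₃)
      by-cases (no ¬σ) rewrite B-chain t₁ t₂ t₃ ¬σ = refl

  ∑²-edge : (c : Fun₁) (x y : Vertex) → ∑² (λ u v → c u v * edge u v x y) ≡ c x y
  ∑²-edge c x y = begin
    ∑² (λ u v → c u v * (δᵥ x u * δᵥ y v))
      ≡⟨ ∑²-cong (λ u v → trans (cong₂ (λ p q → c u v * (p * q)) (δᵥ-sym x u) (δᵥ-sym y v))
                                (rearrange (c u v) (δᵥ u x) (δᵥ v y))) ⟩
    ∑² (λ u v → δᵥ v y * (δᵥ u x * c u v))
      ≡⟨ ∑-cong (λ u → ∑-δᵥ y (λ v → δᵥ u x * c u v)) ⟩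
    ∑ (λ u → δᵥ u x * c u y)
      ≡⟨ ∑-δᵥ x (λ u → c u y) ⟩
    c x y ∎
    where
    open ≡-Reasoning
    rearrange : ∀ k p q → k * (p * q) ≡ q * (p * k)
    rearrange = solve-∀

  outflow≡inflow : (c : Fun₁) → δ₁ c ≈₀ zero₀ → (u : Vertex) → ∑ (c u) ≡ ∑ (λ w → c w u)
  outflow≡inflow c δc≡0 u = sym (ℤP.i-j≡0⇒i≡j _ _ (δc≡0 u))

  ⟨cycle∣coboundary⟩≡0 : (c : Fun₁) → δ₁ c ≈₀ zero₀ → (p : Vertex → ℤ) →
    ⟨ c ∣ (λ u v → p u - p v) ⟩ ≡ 0ℤ
  ⟨cycle∣coboundary⟩≡0 c δc≡0 p = begin
    ∑² (λ u v → c u v * (p u - p v))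
      ≡⟨ ∑²-cong (λ u v → distribˡ (c u v) (p u) (p v)) ⟩
    ∑² (λ u v → c u v * p u - c u v * p v)
      ≡⟨ ∑²-− _ _ ⟩
    ∑² (λ u v → c u v * p u) - ∑² (λ u v → c u v * p v)
      ≡⟨ cong₂ _-_ (∑-cong (λ u → ∑-*ʳ (p u) (c u)))
                   (trans (∑-comm _) (∑-cong (λ v → ∑-*ʳ (p v) (λ u → c u v)))) ⟩
    ∑ (λ u → ∑ (c u) * p u) - ∑ (λ v → ∑ (λ u → c u v) * p v)
      ≡⟨ cong (_- ∑ (λ v → ∑ (λ u → c u v) * p v)) (∑-cong (λ u → cong (_* p u) (outflow≡inflow c δc≡0 u))) ⟩
    ∑ (λ v → ∑ (λ u → c u v) * p v) - ∑ (λ v → ∑ (λ u → c u v) * p v)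
      ≡⟨ ℤP.+-inverseʳ (∑ (λ v → ∑ (λ u → c u v) * p v)) ⟩
    0ℤ ∎
    where
    open ≡-Reasoning
    distribˡ : ∀ k a b → k * (a - b) ≡ k * a - k * b
    distribˡ = solve-∀

module Cycle (m : ℕ) where

  top : ℕ
  top = suc (suc (suc m))

  d : ℕ
  d = suc top

  toℕ-d-mod-d : toℕ (d mod d) ≡ 0
  toℕ-d-mod-d = trans (FinP.toℕ-fromℕ< _) (n%n≡0 d)

  next : Fin d → Fin d
  next b = suc (toℕ b) mod d

  prev : Fin d → Fin d
  prev Fin.zero    = fromℕ top
  prev (Fin.suc b) = inject₁ b

  succ-next : (b : Fin d) → CycSucc d b (next b)
  succ-next b with suc (toℕ b) ℕ.<? d
  ... | yes b+1<d = inj₁ (toℕ-mod b+1<d)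
  ... | no  b+1≮d = inj₂ (b+1≡d , trans (cong (λ n → toℕ (n mod d)) b+1≡d) toℕ-d-mod-d)
    where
    b+1≡d : suc (toℕ b) ≡ d
    b+1≡d = ℕP.≤-antisym (FinP.toℕ<n b) (ℕP.≮⇒≥ b+1≮d)

  succ⇒≡next : {b b′ : Fin d} → CycSucc d b b′ → b′ ≡ next b
  succ⇒≡next {b} {b′} (inj₁ b′≡b+1) = trans (sym (mod-toℕ b′)) (cong (_mod d) b′≡b+1)
  succ⇒≡next {b} {b′} (inj₂ (b+1≡d , b′≡0)) =
    FinP.toℕ-injective (trans b′≡0 (sym (trans (cong (λ n → toℕ (n mod d)) b+1≡d) toℕ-d-mod-d)))

  succ-prev : (b : Fin d) → CycSucc d (prev b) b
  succ-prev Fin.zero    = inj₂ (cong suc (FinP.toℕ-fromℕ top) , refl)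
  succ-prev (Fin.suc b) = inj₁ (cong suc (sym (FinP.toℕ-inject₁ b)))

  succ⇒≡prev : {b′ b : Fin d} → CycSucc d b′ b → b′ ≡ prev b
  succ⇒≡prev {b′} {Fin.suc b} (inj₁ b+1≡b′+1) =
    FinP.toℕ-injective (trans (sym (ℕP.suc-injective b+1≡b′+1)) (sym (FinP.toℕ-inject₁ b)))
  succ⇒≡prev {b′} {Fin.zero} (inj₂ (b′+1≡d , _)) =
    FinP.toℕ-injective (trans (ℕP.suc-injective b′+1≡d) (sym (FinP.toℕ-fromℕ top)))
  succ⇒≡prev {b′} {Fin.suc b} (inj₂ (_ , ()))

  𝟙-succ≡δ-next : (b b′ : Fin d) → 𝟙 (cycSucc? d b b′) ≡ δ b′ (next b)
  𝟙-succ≡δ-next b b′ = 𝟙≡δ (cycSucc? d b b′) succ⇒≡next (λ { refl → succ-next b })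

  𝟙-succ≡δ-prev : (b b′ : Fin d) → 𝟙 (cycSucc? d b′ b) ≡ δ b′ (prev b)
  𝟙-succ≡δ-prev b b′ = 𝟙≡δ (cycSucc? d b′ b) succ⇒≡prev (λ { refl → succ-prev b })

  wraps? : (b b′ : Fin d) → Dec (toℕ b ≡ top × toℕ b′ ≡ 0)
  wraps? b b′ = (toℕ b ℕ.≟ top) ×-dec (toℕ b′ ℕ.≟ 0)

  winding : Fin d → Fin d → ℤ
  winding b b′ = 𝟙 (wraps? b b′) - 𝟙 (wraps? b′ b)

  winding-antisym : (b b′ : Fin d) → winding b b′ ≡ - winding b′ b
  winding-antisym b b′ = antisym (𝟙 (wraps? b b′)) (𝟙 (wraps? b′ b))
    where
    antisym : ∀ p q → p - q ≡ - (q - p)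
    antisym = solve-∀

  winding-refl : (b : Fin d) → winding b b ≡ 0ℤ
  winding-refl b = ℤP.+-inverseʳ (𝟙 (wraps? b b))

  winding-step : (b b′ : Fin d) → toℕ b′ ≡ suc (toℕ b) → winding b b′ ≡ 0ℤ
  winding-step b b′ b′≡b+1 =
    cong₂ _-_ (𝟙-no (wraps? b b′) λ (_ , b′≡0) → ℕP.1+n≢0 (trans (sym b′≡b+1) b′≡0))
              (𝟙-no (wraps? b′ b) λ (b′≡top , b≡0) →
                ℕP.1+n≢0 (ℕP.suc-injective (trans (sym b′≡top) (trans b′≡b+1 (cong suc b≡0)))))

  winding-wrap : (b b′ : Fin d) → suc (toℕ b) ≡ d → toℕ b′ ≡ 0 → winding b b′ ≡ 1ℤ
  winding-wrap b b′ b+1≡d b′≡0 =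
    cong₂ _-_ (𝟙-yes (wraps? b b′) (ℕP.suc-injective b+1≡d , b′≡0))
              (𝟙-no (wraps? b′ b) λ (b′≡top , _) → ℕP.0≢1+n (trans (sym b′≡0) b′≡top))

  -- Displacement of the lift of the edge b → b′ to the universal cover ℤ of the cycle.
  lift : Fin d → Fin d → ℤ
  lift b b′ = (ℤ.+ toℕ b′ - ℤ.+ toℕ b) + ℤ.+ d * winding b b′

  lift-succ : {b b′ : Fin d} → CycSucc d b b′ → lift b b′ ≡ 1ℤ
  lift-succ {b} {b′} (inj₁ b′≡b+1) = begin
    (ℤ.+ toℕ b′ - ℤ.+ toℕ b) + ℤ.+ d * winding b b′
      ≡⟨ cong₂ (λ n w → (ℤ.+ n - ℤ.+ toℕ b) + ℤ.+ d * w) b′≡b+1 (winding-step b b′ b′≡b+1) ⟩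
    (1ℤ + ℤ.+ toℕ b - ℤ.+ toℕ b) + ℤ.+ d * 0ℤ
      ≡⟨ step (ℤ.+ toℕ b) (ℤ.+ d) ⟩
    1ℤ ∎
    where
    open ≡-Reasoning
    step : ∀ x k → (1ℤ + x - x) + k * 0ℤ ≡ 1ℤ
    step = solve-∀
  lift-succ {b} {b′} (inj₂ (b+1≡d , b′≡0)) = begin
    (ℤ.+ toℕ b′ - ℤ.+ toℕ b) + ℤ.+ d * winding b b′
      ≡⟨ cong₂ (λ n w → (ℤ.+ n - ℤ.+ toℕ b) + ℤ.+ d * w) b′≡0 (winding-wrap b b′ b+1≡d b′≡0) ⟩
    (0ℤ - ℤ.+ toℕ b) + ℤ.+ d * 1ℤ
      ≡⟨ cong (λ n → (0ℤ - ℤ.+ toℕ b) + ℤ.+ n * 1ℤ) (sym b+1≡d) ⟩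
    (0ℤ - ℤ.+ toℕ b) + (1ℤ + ℤ.+ toℕ b) * 1ℤ
      ≡⟨ wrap (ℤ.+ toℕ b) ⟩
    1ℤ ∎
    where
    open ≡-Reasoning
    wrap : ∀ x → (0ℤ - x) + (1ℤ + x) * 1ℤ ≡ 1ℤ
    wrap = solve-∀

  lift-antisym : (b b′ : Fin d) → lift b b′ ≡ - lift b′ b
  lift-antisym b b′ = trans (cong (λ w → (ℤ.+ toℕ b′ - ℤ.+ toℕ b) + ℤ.+ d * w) (winding-antisym b b′))
                            (antisym (ℤ.+ toℕ b) (ℤ.+ toℕ b′) (ℤ.+ d) (winding b′ b))
    where
    antisym : ∀ x x′ k w → (x′ - x) + k * (- w) ≡ - ((x - x′) + k * w)
    antisym = solve-∀

  lift-refl : (b : Fin d) → lift b b ≡ 0ℤ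
  lift-refl b = begin
    (ℤ.+ toℕ b - ℤ.+ toℕ b) + ℤ.+ d * winding b b
      ≡⟨ cong₂ _+_ (ℤP.+-inverseʳ (ℤ.+ toℕ b)) (cong (ℤ.+ d *_) (winding-refl b)) ⟩
    0ℤ + ℤ.+ d * 0ℤ
      ≡⟨ trans (ℤP.+-identityˡ _) (ℤP.*-zeroʳ (ℤ.+ d)) ⟩
    0ℤ ∎
    where open ≡-Reasoning

  ∣lift∣≤1 : {b b′ : Fin d} → CycAdj d b b′ → ℤ.∣ lift b b′ ∣ ≤ 1
  ∣lift∣≤1 {b} (inj₁ refl) = ℕP.≤-trans (ℕP.≤-reflexive (cong ℤ.∣_∣ (lift-refl b))) z≤n
  ∣lift∣≤1 (inj₂ (inj₁ succ)) = ℕP.≤-reflexive (cong ℤ.∣_∣ (lift-succ succ))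
  ∣lift∣≤1 {b} {b′} (inj₂ (inj₂ succ)) =
    ℕP.≤-reflexive (trans (cong ℤ.∣_∣ (lift-antisym b b′))
                          (trans (ℤP.∣-i∣≡∣i∣ (lift b′ b)) (cong ℤ.∣_∣ (lift-succ succ))))

  -- The lifted displacements around a triangle add up to d times the coboundary of the
  -- winding number, yet each has absolute value at most 1; as d > 3 the coboundary is 0.
  winding-cocycle : {b₁ b₂ b₃ : Fin d} → CycAdj d b₁ b₂ → CycAdj d b₁ b₃ → CycAdj d b₂ b₃ →
    winding b₂ b₃ - winding b₁ b₃ + winding b₁ b₂ ≡ 0ℤ
  winding-cocycle {b₁} {b₂} {b₃} b₁~b₂ b₁~b₃ b₂~b₃ = d∣X∣≤3⇒X≡0 (begin
    d ℕ.* ℤ.∣ X ∣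
      ≡⟨ sym (ℤP.abs-* (ℤ.+ d) X) ⟩
    ℤ.∣ ℤ.+ d * X ∣
      ≡⟨ cong ℤ.∣_∣ (telescope (ℤ.+ toℕ b₁) (ℤ.+ toℕ b₂) (ℤ.+ toℕ b₃) (ℤ.+ d)
                               (winding b₂ b₃) (winding b₁ b₃) (winding b₁ b₂)) ⟩
    ℤ.∣ lift b₂ b₃ - lift b₁ b₃ + lift b₁ b₂ ∣
      ≤⟨ ℕP.≤-trans (ℤP.∣i+j∣≤∣i∣+∣j∣ (lift b₂ b₃ - lift b₁ b₃) _)
                    (ℕP.+-monoˡ-≤ _ (ℤP.∣i-j∣≤∣i∣+∣j∣ (lift b₂ b₃) _)) ⟩
    ℤ.∣ lift b₂ b₃ ∣ ℕ.+ ℤ.∣ lift b₁ b₃ ∣ ℕ.+ ℤ.∣ lift b₁ b₂ ∣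
      ≤⟨ ℕP.+-mono-≤ (ℕP.+-mono-≤ (∣lift∣≤1 b₂~b₃) (∣lift∣≤1 b₁~b₃)) (∣lift∣≤1 b₁~b₂) ⟩
    3 ∎)
    where
    open ℕP.≤-Reasoning
    X : ℤ
    X = winding b₂ b₃ - winding b₁ b₃ + winding b₁ b₂
    telescope : ∀ x₁ x₂ x₃ k w₂₃ w₁₃ w₁₂ →
      k * (w₂₃ - w₁₃ + w₁₂) ≡ ((x₃ - x₂) + k * w₂₃) - ((x₃ - x₁) + k * w₁₃) + ((x₂ - x₁) + k * w₁₂)
    telescope = solve-∀
    d∣X∣≤3⇒X≡0 : d ℕ.* ℤ.∣ X ∣ ≤ 3 → X ≡ 0ℤ
    d∣X∣≤3⇒X≡0 d∣X∣≤3 with ℤ.∣ X ∣ in ∣X∣≡n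
    ... | zero  = ℤP.∣i∣≡0⇒i≡0 ∣X∣≡n
    ... | suc n = ⊥-elim (ℕP.<⇒≱ (ℕP.≤-trans (s≤s (s≤s (s≤s (s≤s z≤n)))) (ℕP.m≤m*n d (suc n))) d∣X∣≤3)

module Prism (ℓ m : ℕ) where
  open Cycle m public
  open Complex ℓ d public
  open Chains ℓ d public

  φ : Fun₁
  φ u v = winding (proj₂ u) (proj₂ v)

  φ-isCocycle : IsCocycle₁ φ
  φ-isCocycle u v w (u~v , u~w , v~w) =
    winding-cocycle (eqOrAdj⇒cycAdj u v u~v) (eqOrAdj⇒cycAdj u w u~w) (eqOrAdj⇒cycAdj v w v~w)

  -- The spanning tree rooted at (0 , 0). Indices are reduced modulo the number of vertices,
  -- which is harmless: they never exceed it where used.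
  rimPath : ℕ → Fun₁
  rimPath zero    = 0₁
  rimPath (suc k) = rimPath k +₁ edge (Fin.zero , k mod d) (Fin.zero , suc k mod d)

  columnPath : ℕ → Fin d → Fun₁
  columnPath zero    b = 0₁
  columnPath (suc k) b = columnPath k b +₁ edge (k mod suc ℓ , b) (suc k mod suc ℓ , b)

  treePath : Vertex → Fun₁
  treePath (a , b) = rimPath (toℕ b) +₁ columnPath (toℕ a) b

  rimLoop : Fun₁
  rimLoop = rimPath d

  loop : Vertex → Vertex → Fun₁
  loop u v x y = edge u v x y + treePath u x y - treePath v x y - φ u v * rimLoop x y

  LoopBounds : Vertex → Vertex → Set
  LoopBounds u v = IsBoundary₁ (loop u v)

  loop-triangle : (u v w : Vertex) → Simplex₂ u v w →
    IsBoundary₁ (λ x y → loop u v x y + loop v w x y - loop u w x y)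
  loop-triangle u v w σ = isBoundary-resp (λ x y → begin
      ∂triangle u v w x y
        ≡⟨ sym (ℤP.+-identityʳ _) ⟩
      ∂triangle u v w x y - 0ℤ * rimLoop x y
        ≡⟨ cong (λ t → ∂triangle u v w x y - t * rimLoop x y) (sym (φ-isCocycle u v w σ)) ⟩
      ∂triangle u v w x y - (φ v w - φ u w + φ u v) * rimLoop x y
        ≡⟨ regroup (edge u v x y) (edge v w x y) (edge u w x y) (treePath u x y) (treePath v x y) (treePath w x y)
                   (φ u v) (φ v w) (φ u w) (rimLoop x y) ⟩
      loop u v x y + loop v w x y - loop u w x y ∎)
    (isBoundary-triangle u v w σ)
    where
    open ≡-Reasoning
    regroup : ∀ e₁₂ e₂₃ e₁₃ p₁ p₂ p₃ w₁₂ w₂₃ w₁₃ z →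
      (e₂₃ - e₁₃ + e₁₂) - (w₂₃ - w₁₃ + w₁₂) * z
        ≡ (e₁₂ + p₁ - p₂ - w₁₂ * z) + (e₂₃ + p₂ - p₃ - w₂₃ * z) - (e₁₃ + p₁ - p₃ - w₁₃ * z)
    regroup = solve-∀

  bounds-trans : (u v w : Vertex) → Simplex₂ u v w → LoopBounds u v → LoopBounds v w → LoopBounds u w
  bounds-trans u v w σ ∂uv ∂vw =
    isBoundary-resp (λ x y → cancel (loop u v x y) (loop v w x y) (loop u w x y))
      (isBoundary-−₁ (isBoundary-+ ∂uv ∂vw) (loop-triangle u v w σ))
    where
    cancel : ∀ p q r → (p + q) - (p + q - r) ≡ r
    cancel = solve-∀

  bounds-cancel : (u v w : Vertex) → Simplex₂ u v w → LoopBounds u v → LoopBounds u w → LoopBounds v w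
  bounds-cancel u v w σ ∂uv ∂uw =
    isBoundary-resp (λ x y → cancel (loop u v x y) (loop v w x y) (loop u w x y))
      (isBoundary-+ (isBoundary-−₁ (loop-triangle u v w σ) ∂uv) ∂uw)
    where
    cancel : ∀ p q r → (p + q - r) - p + r ≡ q
    cancel = solve-∀

  bounds-refl : (u : Vertex) → LoopBounds u u
  bounds-refl u = isBoundary-resp (λ x y → cancel (loop u u x y))
    (loop-triangle u u u (inj₁ refl , inj₁ refl , inj₁ refl))
    where
    cancel : ∀ p → p + p - p ≡ p
    cancel = solve-∀

  bounds-sym : (u v : Vertex) → EqOrAdj u v → LoopBounds u v → LoopBounds v u
  bounds-sym u v u~v ∂uv = bounds-cancel u v u (u~v , inj₁ refl , eqOrAdj-sym u v u~v) ∂uv (bounds-refl u)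

  loop≡0⇒bounds : {u v : Vertex} → (∀ x y → loop u v x y ≡ 0ℤ) → LoopBounds u v
  loop≡0⇒bounds loop≡0 = isBoundary-resp (λ x y → sym (loop≡0 x y)) isBoundary-0

  rimPath-succ : {b b′ : Fin d} → CycSucc d b b′ →
    rimPath (suc (toℕ b)) ≈₁ rimPath (toℕ b) +₁ edge (Fin.zero , b) (Fin.zero , b′)
  rimPath-succ {b} {b′} succ x y =
    cong₂ (λ b₀ b₁ → rimPath (toℕ b) x y + edge (Fin.zero , b₀) (Fin.zero , b₁) x y)
          (mod-toℕ b) (sym (succ⇒≡next succ))

  columnPath-suc : (a a′ : Fin (suc ℓ)) (b : Fin d) → toℕ a′ ≡ suc (toℕ a) →
    columnPath (toℕ a′) b ≈₁ columnPath (toℕ a) b +₁ edge (a , b) (a′ , b)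
  columnPath-suc a a′ b a′≡a+1 x y = trans (cong (λ k → columnPath k b x y) a′≡a+1)
    (cong₂ (λ a₀ a₁ → columnPath (toℕ a) b x y + edge (a₀ , b) (a₁ , b) x y)
           (mod-toℕ a) (trans (cong (_mod suc ℓ) (sym a′≡a+1)) (mod-toℕ a′)))

  bounds-up : (a a′ : Fin (suc ℓ)) (b : Fin d) → toℕ a′ ≡ suc (toℕ a) → LoopBounds (a , b) (a′ , b)
  bounds-up a a′ b a′≡a+1 = loop≡0⇒bounds λ x y → begin
    e x y + (rimPath (toℕ b) x y + columnPath (toℕ a) b x y)
      - (rimPath (toℕ b) x y + columnPath (toℕ a′) b x y) - winding b b * rimLoop x y
      ≡⟨ cong₂ (λ p w → e x y + (rimPath (toℕ b) x y + columnPath (toℕ a) b x y)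
                          - (rimPath (toℕ b) x y + p) - w * rimLoop x y)
               (columnPath-suc a a′ b a′≡a+1 x y) (winding-refl b) ⟩
    e x y + (rimPath (toℕ b) x y + columnPath (toℕ a) b x y)
      - (rimPath (toℕ b) x y + (columnPath (toℕ a) b x y + e x y)) - 0ℤ * rimLoop x y
      ≡⟨ cancel (e x y) (rimPath (toℕ b) x y) (columnPath (toℕ a) b x y) (rimLoop x y) ⟩
    0ℤ ∎
    where
    open ≡-Reasoning
    e : Fun₁
    e = edge (a , b) (a′ , b)
    cancel : ∀ p r c z → p + (r + c) - (r + (c + p)) - 0ℤ * z ≡ 0ℤ
    cancel = solve-∀

  bounds-rim : {b b′ : Fin d} → CycSucc d b b′ → LoopBounds (Fin.zero , b) (Fin.zero , b′)
  bounds-rim {b} {b′} succ@(inj₁ b′≡b+1) = loop≡0⇒bounds λ x y → begin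
    e x y + (rimPath (toℕ b) x y + 0ℤ) - (rimPath (toℕ b′) x y + 0ℤ) - winding b b′ * rimLoop x y
      ≡⟨ cong₂ (λ p w → e x y + (rimPath (toℕ b) x y + 0ℤ) - (p + 0ℤ) - w * rimLoop x y)
               (trans (cong (λ k → rimPath k x y) b′≡b+1) (rimPath-succ succ x y)) (winding-step b b′ b′≡b+1) ⟩
    e x y + (rimPath (toℕ b) x y + 0ℤ) - ((rimPath (toℕ b) x y + e x y) + 0ℤ) - 0ℤ * rimLoop x y
      ≡⟨ cancel (e x y) (rimPath (toℕ b) x y) (rimLoop x y) ⟩
    0ℤ ∎
    where
    open ≡-Reasoning
    e : Fun₁
    e = edge (Fin.zero , b) (Fin.zero , b′)
    cancel : ∀ p r z → p + (r + 0ℤ) - ((r + p) + 0ℤ) - 0ℤ * z ≡ 0ℤ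
    cancel = solve-∀
  bounds-rim {b} {b′} succ@(inj₂ (b+1≡d , b′≡0)) = loop≡0⇒bounds λ x y → begin
    e x y + (rimPath (toℕ b) x y + 0ℤ) - (rimPath (toℕ b′) x y + 0ℤ) - winding b b′ * rimLoop x y
      ≡⟨ cong₂ (λ p w → e x y + (rimPath (toℕ b) x y + 0ℤ) - (p + 0ℤ) - w * rimLoop x y)
               (cong (λ k → rimPath k x y) b′≡0) (winding-wrap b b′ b+1≡d b′≡0) ⟩
    e x y + (rimPath (toℕ b) x y + 0ℤ) - (0ℤ + 0ℤ) - 1ℤ * rimPath d x y
      ≡⟨ cong (λ z → e x y + (rimPath (toℕ b) x y + 0ℤ) - (0ℤ + 0ℤ) - 1ℤ * z)
              (trans (cong (λ k → rimPath k x y) (sym b+1≡d)) (rimPath-succ succ x y)) ⟩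
    e x y + (rimPath (toℕ b) x y + 0ℤ) - (0ℤ + 0ℤ) - 1ℤ * (rimPath (toℕ b) x y + e x y)
      ≡⟨ cancel (e x y) (rimPath (toℕ b) x y) ⟩
    0ℤ ∎
    where
    open ≡-Reasoning
    e : Fun₁
    e = edge (Fin.zero , b) (Fin.zero , b′)
    cancel : ∀ p r → p + (r + 0ℤ) - (0ℤ + 0ℤ) - 1ℤ * (r + p) ≡ 0ℤ
    cancel = solve-∀

  bounds-horizontal : (a : Fin (suc ℓ)) {b b′ : Fin d} → CycSucc d b b′ → LoopBounds (a , b) (a , b′)
  bounds-horizontal = <-weakInduction HorizontalBounds bounds-rim climb
    where
    HorizontalBounds : Fin (suc ℓ) → Set
    HorizontalBounds a = ∀ {b b′} → CycSucc d b b′ → LoopBounds (a , b) (a , b′)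
    -- The square between levels a and a + 1 over the edge b → b′ is filled by two triangles.
    climb : ∀ a → HorizontalBounds (inject₁ a) → HorizontalBounds (Fin.suc a)
    climb a below {b} {b′} succ =
      bounds-cancel (a₀ , b) (a₁ , b) (a₁ , b′)
        (inj₂ (up , inj₁ refl) , inj₂ (up , cyc) , inj₂ (inj₁ refl , cyc))
        (bounds-up a₀ a₁ b a₁≡a₀+1)
        (bounds-trans (a₀ , b) (a₀ , b′) (a₁ , b′)
          (inj₂ (inj₁ refl , cyc) , inj₂ (up , cyc) , inj₂ (up , inj₁ refl))
          (below succ) (bounds-up a₀ a₁ b′ a₁≡a₀+1))
      where
      a₀ a₁ : Fin (suc ℓ)
      a₀ = inject₁ a
      a₁ = Fin.suc a
      a₁≡a₀+1 : toℕ a₁ ≡ suc (toℕ a₀)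
      a₁≡a₀+1 = cong suc (sym (FinP.toℕ-inject₁ a))
      up : PathAdj a₀ a₁
      up = inj₂ (inj₁ (sym a₁≡a₀+1))
      cyc : CycAdj d b b′
      cyc = inj₂ (inj₁ succ)

  bounds-adjacent : (u v : Vertex) → EqOrAdj u v → LoopBounds u v
  bounds-adjacent u .u (inj₁ refl) = bounds-refl u
  bounds-adjacent (a , b) (a′ , b′) (inj₂ (a~a′ , b~b′)) =
    bounds-trans (a , b) (a , b′) (a′ , b′)
      (inj₂ (inj₁ refl , b~b′) , inj₂ (a~a′ , b~b′) , inj₂ (a~a′ , inj₁ refl))
      (horizontal b~b′) (vertical a~a′)
    where
    horizontal : {β β′ : Fin d} → CycAdj d β β′ → LoopBounds (a , β) (a , β′)
    horizontal (inj₁ refl)        = bounds-refl (a , _)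
    horizontal (inj₂ (inj₁ succ)) = bounds-horizontal a succ
    horizontal (inj₂ (inj₂ succ)) =
      bounds-sym (a , _) (a , _) (inj₂ (inj₁ refl , inj₂ (inj₁ succ))) (bounds-horizontal a succ)
    vertical : {α α′ : Fin (suc ℓ)} → PathAdj α α′ → LoopBounds (α , b′) (α′ , b′)
    vertical {α} (inj₁ α≡α′) rewrite FinP.toℕ-injective α≡α′ = bounds-refl (_ , b′)
    vertical {α} {α′} (inj₂ (inj₁ up)) = bounds-up α α′ b′ (sym up)
    vertical {α} {α′} (inj₂ (inj₂ down)) =
      bounds-sym (α′ , b′) (α , b′) (inj₂ (inj₂ (inj₁ down) , inj₁ refl)) (bounds-up α′ α b′ (sym down))

  isBoundary-chain·loop : (c : Fun₁) → IsChain₁ c → (u v : Vertex) → IsBoundary₁ (c u v · loop u v)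
  isBoundary-chain·loop c c-chain u v with eqOrAdj? u v
  ... | yes u~v = isBoundary-· (c u v) (bounds-adjacent u v u~v)
  ... | no ¬u~v = isBoundary-resp
    (λ x y → sym (trans (cong (_* loop u v x y) (c-chain u v ¬u~v)) (ℤP.*-zeroˡ (loop u v x y))))
    isBoundary-0

  ∑²-chain·loop : (c : Fun₁) → δ₁ c ≈₀ zero₀ → (x y : Vertex) →
    ∑² (λ u v → c u v * loop u v x y) ≡ c x y - ⟨ c ∣ φ ⟩ * rimLoop x y
  ∑²-chain·loop c δc≡0 x y = begin
    ∑² (λ u v → c u v * loop u v x y)
      ≡⟨ ∑²-cong (λ u v → expand (c u v) (edge u v x y) (treePath u x y) (treePath v x y) (φ u v) (rimLoop x y)) ⟩
    ∑² (λ u v → (c u v * edge u v x y + c u v * (treePath u x y - treePath v x y)) - c u v * φ u v * rimLoop x y)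
      ≡⟨ ∑²-− (λ u v → c u v * edge u v x y + c u v * (treePath u x y - treePath v x y))
              (λ u v → c u v * φ u v * rimLoop x y) ⟩
    ∑² (λ u v → c u v * edge u v x y + c u v * (treePath u x y - treePath v x y)) - ∑² (λ u v → c u v * φ u v * rimLoop x y)
      ≡⟨ cong₂ _-_ (trans (∑²-+ (λ u v → c u v * edge u v x y) (λ u v → c u v * (treePath u x y - treePath v x y)))
                          (cong₂ _+_ (∑²-edge c x y) (⟨cycle∣coboundary⟩≡0 c δc≡0 (λ u → treePath u x y))))
                   (trans (∑-cong (λ u → ∑-*ʳ (rimLoop x y) (λ v → c u v * φ u v)))
                          (∑-*ʳ (rimLoop x y) (λ u → ∑ (λ v → c u v * φ u v)))) ⟩
    c x y + 0ℤ - ⟨ c ∣ φ ⟩ * rimLoop x y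
      ≡⟨ cong (_- ⟨ c ∣ φ ⟩ * rimLoop x y) (ℤP.+-identityʳ (c x y)) ⟩
    c x y - ⟨ c ∣ φ ⟩ * rimLoop x y ∎
    where
    open ≡-Reasoning
    expand : ∀ k e p q w z → k * (e + p - q - w * z) ≡ (k * e + k * (p - q)) - k * w * z
    expand = solve-∀

  cycle-homologous : (c : Fun₁) → IsCycle₁ c → IsBoundary₁ (c −₁ (⟨ c ∣ φ ⟩ · rimLoop))
  cycle-homologous c (c-chain , δc≡0) = isBoundary-resp (∑²-chain·loop c δc≡0)
    (isBoundary-∑ _ (λ u → isBoundary-∑ _ (λ v → isBoundary-chain·loop c c-chain u v)))

  slice≡ : (I a a′ : Fin (suc ℓ)) (b b′ : Fin d) →
    slice I (a , b) (a′ , b′) ≡ δ a I * (δ a′ I * 𝟙 (cycSucc? d b b′))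
  slice≡ I a a′ b b′ = trans (if-∧≡𝟙 p q r) (sym (trans (cong (δ a I *_) (𝟙-× q r)) (𝟙-× p (q ×-dec r))))
    where
    p : Dec (a ≡ I)
    p = a Fin.≟ I
    q : Dec (a′ ≡ I)
    q = a′ Fin.≟ I
    r : Dec (CycSucc d b b′)
    r = cycSucc? d b b′

  slice-isChain : (I : Fin (suc ℓ)) → IsChain₁ (slice I)
  slice-isChain I (a , b) (a′ , b′) ¬u~v =
    trans (if-∧≡𝟙 (a Fin.≟ I) (a′ Fin.≟ I) (cycSucc? d b b′))
          (𝟙-no ((a Fin.≟ I) ×-dec (a′ Fin.≟ I) ×-dec cycSucc? d b b′)
    λ (a≡I , a′≡I , succ) → ¬u~v (inj₂ (inj₁ (cong toℕ (trans a≡I (sym a′≡I))) , inj₂ (inj₁ succ))))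

  ∑-slice-out : (I : Fin (suc ℓ)) (u : Vertex) (f : Vertex → ℤ) →
    ∑ (λ v → slice I u v * f v) ≡ δ (proj₁ u) I * f (I , next (proj₂ u))
  ∑-slice-out I (a , b) f = trans (∑-cong term) (∑-δᵥ (I , next b) (λ v → δ a I * f v))
    where
    rearrange : ∀ p q r s → p * (q * r) * s ≡ q * r * (p * s)
    rearrange = solve-∀
    term : ∀ v → slice I (a , b) v * f v ≡ δᵥ v (I , next b) * (δ a I * f v)
    term (a′ , b′) = trans (cong (_* f (a′ , b′)) (trans (slice≡ I a a′ b b′)
                                                         (cong (λ t → δ a I * (δ a′ I * t)) (𝟙-succ≡δ-next b b′))))
                           (rearrange (δ a I) (δ a′ I) (δ b′ (next b)) (f (a′ , b′)))

  ∑-slice-in : (I : Fin (suc ℓ)) (v : Vertex) (f : Vertex → ℤ) →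
    ∑ (λ u → slice I u v * f u) ≡ δ (proj₁ v) I * f (I , prev (proj₂ v))
  ∑-slice-in I (a′ , b′) f = trans (∑-cong term) (∑-δᵥ (I , prev b′) (λ u → δ a′ I * f u))
    where
    rearrange : ∀ p q r s → p * (q * r) * s ≡ p * r * (q * s)
    rearrange = solve-∀
    term : ∀ u → slice I u (a′ , b′) * f u ≡ δᵥ u (I , prev b′) * (δ a′ I * f u)
    term (a , b) = trans (cong (_* f (a , b)) (trans (slice≡ I a a′ b b′)
                                                     (cong (λ t → δ a I * (δ a′ I * t)) (𝟙-succ≡δ-prev b′ b))))
                         (rearrange (δ a I) (δ a′ I) (δ b (prev b′)) (f (a , b)))

  slice-isCycle : (I : Fin (suc ℓ)) → IsCycle₁ (slice I)
  slice-isCycle I = slice-isChain I , λ x → begin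
    ∑ (λ u → slice I u x) - ∑ (λ v → slice I x v)
      ≡⟨ cong₂ _-_ (trans (∑-cong (λ u → sym (ℤP.*-identityʳ (slice I u x)))) (∑-slice-in I x (λ _ → 1ℤ)))
                   (trans (∑-cong (λ v → sym (ℤP.*-identityʳ (slice I x v)))) (∑-slice-out I x (λ _ → 1ℤ))) ⟩
    δ (proj₁ x) I * 1ℤ - δ (proj₁ x) I * 1ℤ
      ≡⟨ ℤP.+-inverseʳ (δ (proj₁ x) I * 1ℤ) ⟩
    0ℤ ∎
    where open ≡-Reasoning

  winding-next : (b : Fin d) → winding b (next b) ≡ δ b (fromℕ top)
  winding-next b with succ-next b
  ... | inj₁ next≡b+1 = trans (winding-step b (next b) next≡b+1) (sym (δ-≢ b≢top))
    where
    b≢top : b ≢ fromℕ top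
    b≢top refl = ℕP.<⇒≢ (FinP.toℕ<n (next b)) (trans next≡b+1 (cong suc (FinP.toℕ-fromℕ top)))
  ... | inj₂ (b+1≡d , next≡0) = trans (winding-wrap b (next b) b+1≡d next≡0)
    (sym (δ-≡ (FinP.toℕ-injective (trans (ℕP.suc-injective b+1≡d) (sym (FinP.toℕ-fromℕ top))))))

  ⟨slice∣φ⟩≡1 : (I : Fin (suc ℓ)) → ⟨ slice I ∣ φ ⟩ ≡ 1ℤ
  ⟨slice∣φ⟩≡1 I = begin
    ∑ (λ u → ∑ (λ v → slice I u v * φ u v))
      ≡⟨ ∑-cong (λ u → ∑-slice-out I u (φ u)) ⟩
    ∑ (λ u → δ (proj₁ u) I * winding (proj₂ u) (next (proj₂ u)))
      ≡⟨ ∑-cong (λ u → trans (cong (δ (proj₁ u) I *_) (winding-next (proj₂ u))) (sym (ℤP.*-identityʳ _))) ⟩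
    ∑ (λ u → δᵥ u (I , fromℕ top) * 1ℤ)
      ≡⟨ ∑-δᵥ (I , fromℕ top) (λ _ → 1ℤ) ⟩
    1ℤ ∎
    where open ≡-Reasoning

  slice-generates : (I : Fin (suc ℓ)) → H₁InfiniteCyclicGeneratedBy (slice I)
  slice-generates I = slice-isCycle I , homologous-to-multiple , multiple-bounds⇒0
    where
    z : Fun₁
    z = slice I
    homologous-to-multiple : ∀ c → IsCycle₁ c → ∃ λ k → IsBoundary₁ (c −₁ (k · z))
    homologous-to-multiple c c-cycle = ⟨ c ∣ φ ⟩ ,
      isBoundary-resp (λ x y → trans (cong (λ w → (c x y - k * rimLoop x y) - k * (z x y - w * rimLoop x y))
                                           (⟨slice∣φ⟩≡1 I))
                                     (cancel (c x y) k (z x y) (rimLoop x y)))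
        (isBoundary-−₁ (cycle-homologous c c-cycle) (isBoundary-· k (cycle-homologous z (slice-isCycle I))))
      where
      k : ℤ
      k = ⟨ c ∣ φ ⟩
      cancel : ∀ c k s r → (c - k * r) - k * (s - 1ℤ * r) ≡ c - k * s
      cancel = solve-∀
    multiple-bounds⇒0 : ∀ k → IsBoundary₁ (k · z) → k ≡ 0ℤ
    multiple-bounds⇒0 k (B , B-chain , k·z≈δ₂B) = begin
      k                 ≡⟨ sym (ℤP.*-identityʳ k) ⟩
      k * 1ℤ            ≡⟨ cong (k *_) (sym (⟨slice∣φ⟩≡1 I)) ⟩
      k * ⟨ z ∣ φ ⟩     ≡⟨ sym (⟨⟩-· k z φ) ⟩
      ⟨ k · z ∣ φ ⟩     ≡⟨ ⟨⟩-resp-≈₁ φ k·z≈δ₂B ⟩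
      ⟨ δ₂ B ∣ φ ⟩      ≡⟨ ⟨δ₂∣cocycle⟩≡0 φ φ-isCocycle B B-chain ⟩
      0ℤ                ∎
      where open ≡-Reasoning

-- The hypothesis 1 ≤ ℓ is implied by the existence of i; the slice at level ℓ works as well.
lemma7p2 : (ℓ d : ℕ) → 1 ≤ ℓ → 4 ≤ d → (i : Fin ℓ) →
    Complex.H₁InfiniteCyclicGeneratedBy ℓ d (Complex.slice ℓ d (inject₁ i))
lemma7p2 ℓ _ _ (s≤s (s≤s (s≤s (s≤s {n = m} z≤n)))) i = Prism.slice-generates ℓ m (inject₁ i)
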